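{- Consider an instance of the Densest Subset Problem and its LP relaxation as in the context. Suppose $z^*=(x^*,y^*)$ is an optimal (fractional) solution of the LP. Then every nonempty level set $P$ of $z^*$ is a densest subset, and $\delta(P)=c(x^*)$.
   Context: Densest Subset Problem: input is a finite set $U$ with vertex weights $w_v>0$ ($v\in U$), and two multisets $I$ and $S$ of subsets of $U$ (hyperedges), each $e\in I\cup S$ having a value $c_e>0$. For $X\subseteq U$, $I_X=\{e\in I:e\subseteq X\}$, $S_X=\{e\in S:e\cap X\ne\emptyset\}$, $c(F)=\sum_{e\in F}c_e$, $w(X)=\sum_{v\in X}w_v$, and for nonempty $X$, $\delta(X)=\frac{c(I_X)-c(S_X)}{w(X)}$. A densest subset is a nonempty $P\subseteq U$ maximizing $\delta$. LP: maximize $c(x):=\sum_{e\in I}c_ex_e-\sum_{e\in S}c_ex_e$ subject to $\sum_{v\in U}w_vy_v=1$; $x_e\le y_v$ for all $e\in I$, $v\in e$; $x_e\ge y_v$ for all $e\in S$, $v\in e$; $y_v,x_e\ge0$ for all $v\in U$, $e\in I\cup S$. For a feasible $z=(x,y)$, a nonempty $P$ is a level set of $z$ if there is $\rho>0$ with $P=\{v\in U:y_v\ge\rho\}$.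
   Formalization: The vertex weights $w_v$, the values $c_e$, the LP points $z=(x,y)$ and the thresholds $\rho$ are rational, with optimality measured against rational feasible points. -}

module Defs where

open import Data.Nat using (ℕ; zero; suc)
open import Data.Fin using (Fin)
open import Data.Fin.Subset using (Subset; _∈_; _⊆_; _∩_; Nonempty)
open import Data.Fin.Subset.Properties using (_∈?_; _⊆?_; nonempty?)
open import Data.Rational using (ℚ; 0ℚ; 1ℚ; _+_; _*_; _-_; _≤_; _<_; 1/_; ≢-nonZero)
open import Data.Rational.Properties using (_≟_)
open import Relation.Nullary using (yes; no; Dec)
open import Relation.Binary.PropositionalEquality using (_≡_)
open import Data.Product using (_×_; Σ; ∃)
open import Function.Bundles using (_⇔_)

sumFin : (n : ℕ) → (Fin n → ℚ) → ℚ
sumFin zero    f = 0ℚ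
sumFin (suc n) f = f Fin.zero + sumFin n (λ i → f (Fin.suc i))
  where import Data.Fin as Fin

when : ∀ {p} {P : Set p} → Dec P → ℚ → ℚ
when (yes _) a = a
when (no _)  a = 0ℚ

-- A Densest Subset instance on U = Fin n, with I and S multisets
-- given as families indexed by Fin mI and Fin mS.
record Instance (n : ℕ) : Set where
  field
    w   : Fin n → ℚ
    w>0 : ∀ v → 0ℚ < w v
    mI  : ℕ
    eI  : Fin mI → Subset n
    cI  : Fin mI → ℚ
    cI>0 : ∀ i → 0ℚ < cI i
    mS  : ℕ
    eS  : Fin mS → Subset n
    cS  : Fin mS → ℚ
    cS>0 : ∀ j → 0ℚ < cS j

module _ {n : ℕ} (G : Instance n) where
  open Instance G

  wt : Subset n → ℚ
  wt X = sumFin n (λ v → when (v ∈? X) (w v))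

  cIX : Subset n → ℚ
  cIX X = sumFin mI (λ i → when (eI i ⊆? X) (cI i))

  cSX : Subset n → ℚ
  cSX X = sumFin mS (λ j → when (nonempty? (eS j ∩ X)) (cS j))

  -- total inverse on ℚ (1/q for q ≠ 0; 0 otherwise; only used for q = w(X) > 0)
  inv : ℚ → ℚ
  inv q with q ≟ 0ℚ
  ... | yes _ = 0ℚ
  ... | no q≢0 = (1/ q) {{≢-nonZero q≢0}}

  δ : Subset n → ℚ
  δ X = (cIX X - cSX X) * inv (wt X)

  Densest : Subset n → Set
  Densest P = Nonempty P × (∀ X → Nonempty X → δ X ≤ δ P)

  -- LP solutions z = (x, y): x split into its I-part and S-part
  record LPPoint : Set where
    constructor lp
    field
      xI : Fin mI → ℚ
      xS : Fin mS → ℚ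
      y  : Fin n → ℚ

  obj : LPPoint → ℚ
  obj z = sumFin mI (λ i → cI i * LPPoint.xI z i)
        - sumFin mS (λ j → cS j * LPPoint.xS z j)

  Feasible : LPPoint → Set
  Feasible z =
      sumFin n (λ v → w v * y v) ≡ 1ℚ
    × (∀ i v → v ∈ eI i → xI i ≤ y v)
    × (∀ j v → v ∈ eS j → y v ≤ xS j)
    × (∀ v → 0ℚ ≤ y v)
    × (∀ i → 0ℚ ≤ xI i)
    × (∀ j → 0ℚ ≤ xS j)
    where open LPPoint z

  Optimal : LPPoint → Set
  Optimal z = Feasible z × (∀ z' → Feasible z' → obj z' ≤ obj z)

  LevelSet : LPPoint → Subset n → Set
  LevelSet z P = Nonempty P ×
    Σ ℚ (λ ρ → (0ℚ < ρ) × (∀ v → (v ∈ P) ⇔ (ρ ≤ LPPoint.y z v)))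

-- Call a point q a cone point if it satisfies every LP constraint except the normalisation
-- Σ w_v y_v = 1. For a cone point q, (z* + q) / (1 + w·y(q)) is feasible, so optimality of z*
-- gives c(q) ≤ (w·y(q)) c(z*); applied to the indicator point of X this is δ(X) ≤ c(z*).
-- Conversely, for the level set P = {y ≥ ρ} choose ρ₀ ∈ [0, ρ) such that no y_v lies in (ρ₀, ρ),
-- and apply the monotone map t ↦ min(max(t, ρ₀), ρ) − ρ₀ to every coordinate of z*. The result
-- has y = (ρ − ρ₀)·1_P and objective at most (ρ − ρ₀)(c(I_P) − c(S_P)), and the remainder is again
-- a cone point. Linearity of c and of w·y, together with the cone bound on the remainder, give
-- w(P) c(z*) ≤ c(I_P) − c(S_P), i.e. c(z*) ≤ δ(P).

module Submission where

open import Defs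
open import Data.Nat using (ℕ; zero; suc)
open import Data.Fin using (Fin; zero; suc)
open import Data.Fin.Subset using (Subset; _∈_; _∉_; _∩_; Nonempty)
open import Data.Fin.Subset.Properties using (_∈?_; _⊆?_; nonempty?; x∈p∩q⁺; x∈p∩q⁻)
open import Data.List using (_∷_; [])
open import Data.Rational using (ℚ; 0ℚ; 1ℚ; 1/_; _+_; _*_; _-_; -_; _≤_; _<_; _⊓_; _⊔_; positive; nonNegative; ≢-nonZero)
open import Data.Rational.Properties
open import Data.Product using (_×_; _,_; proj₁; proj₂; ∃-syntax)
open import Data.Sum using (inj₁; inj₂)
open import Data.Empty using (⊥-elim)
open import Function using (_∘_; Equivalence)
open import Relation.Binary.PropositionalEquality using (_≡_; refl; sym; trans; cong; cong₂; subst; subst₂; module ≡-Reasoning)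
open import Relation.Nullary using (Dec; yes; no)
open import Relation.Nullary.Decidable.Core using (dec⇒maybe)
open import Tactic.RingSolver using (solve-∀; solve)
open import Tactic.RingSolver.Core.AlmostCommutativeRing using (AlmostCommutativeRing; fromCommutativeRing)

ℚ-ring : AlmostCommutativeRing _ _
ℚ-ring = fromCommutativeRing +-*-commutativeRing (λ q → dec⇒maybe (0ℚ ≟ q))

+-cancelʳ-≤ : ∀ {a b} c → a + c ≤ b + c → a ≤ b
+-cancelʳ-≤ {a} {b} c a+c≤b+c = begin
  a          ≡⟨ solve (a ∷ c ∷ []) ℚ-ring ⟩
  a + c - c  ≤⟨ +-monoˡ-≤ (- c) a+c≤b+c ⟩
  b + c - c  ≡⟨ solve (b ∷ c ∷ []) ℚ-ring ⟩
  b          ∎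
  where open ≤-Reasoning

⊔-lub-< : ∀ {p q r} → p < r → q < r → p ⊔ q < r
⊔-lub-< {p} {q} {r} p<r q<r with ⊔-sel p q
... | inj₁ p⊔q≡p = subst (_< r) (sym p⊔q≡p) p<r
... | inj₂ p⊔q≡q = subst (_< r) (sym p⊔q≡q) q<r

*-monoˡ-≤-≥0 : ∀ {a p q} → 0ℚ ≤ a → p ≤ q → a * p ≤ a * q
*-monoˡ-≤-≥0 {a} 0≤a = *-monoˡ-≤-nonNeg a {{nonNegative 0≤a}}

*-nonNeg : ∀ {a b} → 0ℚ ≤ a → 0ℚ ≤ b → 0ℚ ≤ a * b
*-nonNeg {a} {b} 0≤a 0≤b = subst (_≤ a * b) (*-zeroʳ a) (*-monoˡ-≤-≥0 0≤a 0≤b)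

sumFin-cong : ∀ m {f g : Fin m → ℚ} → (∀ i → f i ≡ g i) → sumFin m f ≡ sumFin m g
sumFin-cong zero    f≗g = refl
sumFin-cong (suc m) f≗g = cong₂ _+_ (f≗g zero) (sumFin-cong m (f≗g ∘ suc))

sumFin-distrib-+ : ∀ m (f g : Fin m → ℚ) →
  sumFin m (λ i → f i + g i) ≡ sumFin m f + sumFin m g
sumFin-distrib-+ zero    f g = sym (+-identityˡ 0ℚ)
sumFin-distrib-+ (suc m) f g =
  trans (cong (f zero + g zero +_) (sumFin-distrib-+ m (f ∘ suc) (g ∘ suc)))
        (interchange (f zero) (g zero) (sumFin m (f ∘ suc)) (sumFin m (g ∘ suc)))
  where
  interchange : ∀ a b c d → (a + b) + (c + d) ≡ (a + c) + (b + d)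
  interchange = solve-∀ ℚ-ring

*-distribˡ-sumFin : ∀ m a (f : Fin m → ℚ) → a * sumFin m f ≡ sumFin m (λ i → a * f i)
*-distribˡ-sumFin zero    a f = *-zeroʳ a
*-distribˡ-sumFin (suc m) a f =
  trans (*-distribˡ-+ a (f zero) _) (cong (a * f zero +_) (*-distribˡ-sumFin m a (f ∘ suc)))

sumFin-mono-≤ : ∀ m {f g : Fin m → ℚ} → (∀ i → f i ≤ g i) → sumFin m f ≤ sumFin m g
sumFin-mono-≤ zero    f≤g = ≤-refl
sumFin-mono-≤ (suc m) f≤g = +-mono-≤ (f≤g zero) (sumFin-mono-≤ m (f≤g ∘ suc))

sumFin-nonNeg : ∀ m {f : Fin m → ℚ} → (∀ i → 0ℚ ≤ f i) → 0ℚ ≤ sumFin m f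
sumFin-nonNeg zero    f≥0 = ≤-refl
sumFin-nonNeg (suc m) f≥0 = +-mono-≤ (f≥0 zero) (sumFin-nonNeg m (f≥0 ∘ suc))

term≤sumFin : ∀ m {f : Fin m → ℚ} → (∀ i → 0ℚ ≤ f i) → ∀ k → f k ≤ sumFin m f
term≤sumFin (suc m) {f} f≥0 zero =
  subst (_≤ sumFin (suc m) f) (+-identityʳ (f zero))
        (+-monoʳ-≤ (f zero) (sumFin-nonNeg m (f≥0 ∘ suc)))
term≤sumFin (suc m) {f} f≥0 (suc k) =
  subst (_≤ sumFin (suc m) f) (+-identityˡ (f (suc k)))
        (+-mono-≤ (f≥0 zero) (term≤sumFin m (f≥0 ∘ suc) k))

dot : ∀ m → (Fin m → ℚ) → (Fin m → ℚ) → ℚ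
dot m c f = sumFin m (λ i → c i * f i)

dot-congʳ : ∀ m c {f g : Fin m → ℚ} → (∀ i → f i ≡ g i) → dot m c f ≡ dot m c g
dot-congʳ m c f≗g = sumFin-cong m (λ i → cong (c i *_) (f≗g i))

dot-distribʳ-+ : ∀ m c (f g : Fin m → ℚ) →
  dot m c (λ i → f i + g i) ≡ dot m c f + dot m c g
dot-distribʳ-+ m c f g =
  trans (sumFin-cong m (λ i → *-distribˡ-+ (c i) (f i) (g i))) (sumFin-distrib-+ m _ _)

dot-*ʳ : ∀ m c a (f : Fin m → ℚ) → dot m c (λ i → a * f i) ≡ a * dot m c f
dot-*ʳ m c a f =
  trans (sumFin-cong m (λ i → swap (c i) a (f i))) (sym (*-distribˡ-sumFin m a _))
  where
  swap : ∀ c a x → c * (a * x) ≡ a * (c * x)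
  swap = solve-∀ ℚ-ring

dot-monoʳ-≤ : ∀ m {c f g : Fin m → ℚ} → (∀ i → 0ℚ ≤ c i) → (∀ i → f i ≤ g i) →
  dot m c f ≤ dot m c g
dot-monoʳ-≤ m c≥0 f≤g = sumFin-mono-≤ m (λ i → *-monoˡ-≤-≥0 (c≥0 i) (f≤g i))

dot-nonNeg : ∀ m {c f : Fin m → ℚ} → (∀ i → 0ℚ ≤ c i) → (∀ i → 0ℚ ≤ f i) → 0ℚ ≤ dot m c f
dot-nonNeg m c≥0 f≥0 = sumFin-nonNeg m (λ i → *-nonNeg (c≥0 i) (f≥0 i))

when-nonNeg : ∀ {p} {P : Set p} (P? : Dec P) {a} → 0ℚ ≤ a → 0ℚ ≤ when P? a
when-nonNeg (yes _) 0≤a = 0≤a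
when-nonNeg (no _)  0≤a = ≤-refl

when-true : ∀ {p} {P : Set p} (P? : Dec P) {a} → P → when P? a ≡ a
when-true (yes _) _ = refl
when-true (no ¬p) p = ⊥-elim (¬p p)

*-when-1 : ∀ {p} {P : Set p} (P? : Dec P) a → a * when P? 1ℚ ≡ when P? a
*-when-1 (yes _) a = *-identityʳ a
*-when-1 (no _)  a = *-zeroʳ a

p≤q⇒0≤q-p : ∀ {p q} → p ≤ q → 0ℚ ≤ q - p
p≤q⇒0≤q-p {p} {q} p≤q = subst (_≤ q - p) (+-inverseʳ p) (+-monoˡ-≤ (- p) p≤q)

p<q⇒0<q-p : ∀ {p q} → p < q → 0ℚ < q - p
p<q⇒0<q-p {p} {q} p<q = subst (_< q - p) (+-inverseʳ p) (+-monoˡ-< (- p) p<q)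

clamp : ℚ → ℚ → ℚ → ℚ
clamp a b t = (t ⊔ a) ⊓ b - a

residual : ℚ → ℚ → ℚ → ℚ
residual a b t = t ⊓ a + (t ⊔ b - b)

module _ {a b : ℚ} where

  residual-mono-≤ : ∀ {s t} → s ≤ t → residual a b s ≤ residual a b t
  residual-mono-≤ s≤t = +-mono-≤ (⊓-monoˡ-≤ a s≤t) (+-monoˡ-≤ (- b) (⊔-monoˡ-≤ b s≤t))

  clamp≤b-a : ∀ t → clamp a b t ≤ b - a
  clamp≤b-a t = +-monoˡ-≤ (- a) (p⊓q≤q (t ⊔ a) b)

  clamp-nonNeg : a ≤ b → ∀ t → 0ℚ ≤ clamp a b t
  clamp-nonNeg a≤b t = p≤q⇒0≤q-p (⊓-glb (p≤q⊔p t a) a≤b)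

  residual-nonNeg : 0ℚ ≤ a → ∀ {t} → 0ℚ ≤ t → 0ℚ ≤ residual a b t
  residual-nonNeg 0≤a {t} 0≤t = +-mono-≤ (⊓-glb 0≤t 0≤a) (p≤q⇒0≤q-p (p≤q⊔p t b))

  clamp-above : a ≤ b → ∀ {t} → b ≤ t → clamp a b t ≡ b - a
  clamp-above a≤b b≤t rewrite p≥q⇒p⊔q≡p (≤-trans a≤b b≤t) | p≥q⇒p⊓q≡q b≤t = refl

  clamp-below : a ≤ b → ∀ {t} → t ≤ a → clamp a b t ≡ 0ℚ
  clamp-below a≤b t≤a rewrite p≤q⇒p⊔q≡q t≤a | p≤q⇒p⊓q≡p a≤b = +-inverseʳ a

  clamp+residual : a ≤ b → ∀ t → clamp a b t + residual a b t ≡ t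
  clamp+residual a≤b t with ≤-total t a
  ... | inj₁ t≤a
    rewrite p≤q⇒p⊔q≡q t≤a | p≤q⇒p⊓q≡p a≤b | p≤q⇒p⊓q≡p t≤a | p≤q⇒p⊔q≡q (≤-trans t≤a a≤b)
    = solve (a ∷ b ∷ t ∷ []) ℚ-ring
  ... | inj₂ a≤t with ≤-total t b
  ...   | inj₁ t≤b
    rewrite p≥q⇒p⊔q≡p a≤t | p≤q⇒p⊓q≡p t≤b | p≥q⇒p⊓q≡q a≤t | p≤q⇒p⊔q≡q t≤b
    = solve (a ∷ b ∷ t ∷ []) ℚ-ring
  ...   | inj₂ b≤t
    rewrite p≥q⇒p⊔q≡p a≤t | p≥q⇒p⊓q≡q b≤t | p≥q⇒p⊓q≡q a≤t | p≥q⇒p⊔q≡p b≤t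
    = solve (a ∷ b ∷ t ∷ []) ℚ-ring

gapBelow : ∀ m (f : Fin m → ℚ) {ρ} → 0ℚ < ρ →
  ∃[ ρ₀ ] 0ℚ ≤ ρ₀ × ρ₀ < ρ × (∀ k → ρ₀ < f k → ρ ≤ f k)
gapBelow zero    f ρ>0 = 0ℚ , ≤-refl , ρ>0 , λ ()
gapBelow (suc m) f {ρ} ρ>0 with gapBelow m (f ∘ suc) ρ>0 | f zero <? ρ
... | ρ₀ , ρ₀≥0 , ρ₀<ρ , gap | yes f₀<ρ =
  f zero ⊔ ρ₀ , ≤-trans ρ₀≥0 (p≤q⊔p (f zero) ρ₀) , ⊔-lub-< f₀<ρ ρ₀<ρ , gap′
  where
  gap′ : ∀ k → f zero ⊔ ρ₀ < f k → ρ ≤ f k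
  gap′ zero    lt = ⊥-elim (<-irrefl refl (≤-<-trans (p≤p⊔q (f zero) ρ₀) lt))
  gap′ (suc k) lt = gap k (≤-<-trans (p≤q⊔p (f zero) ρ₀) lt)
... | ρ₀ , ρ₀≥0 , ρ₀<ρ , gap | no f₀≮ρ = ρ₀ , ρ₀≥0 , ρ₀<ρ , gap′
  where
  gap′ : ∀ k → ρ₀ < f k → ρ ≤ f k
  gap′ zero    _ = ≮⇒≥ f₀≮ρ
  gap′ (suc k)   = gap k

module _ {n : ℕ} (G : Instance n) where
  open Instance G
  open LPPoint

  inv-inverseʳ : ∀ {q} → 0ℚ < q → q * inv G q ≡ 1ℚ
  inv-inverseʳ {q} q>0 with q ≟ 0ℚ
  ... | yes q≡0 = ⊥-elim (<-irrefl (sym q≡0) q>0)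
  ... | no  q≢0 = *-inverseʳ q {{≢-nonZero q≢0}}

  inv-nonNeg : ∀ {q} → 0ℚ < q → 0ℚ ≤ inv G q
  inv-nonNeg {q} q>0 with q ≟ 0ℚ
  ... | yes q≡0 = ⊥-elim (<-irrefl (sym q≡0) q>0)
  ... | no  q≢0 = nonNegative⁻¹ 1/q {{pos⇒nonNeg 1/q {{1/pos⇒pos q {{positive q>0}}}}}}
    where 1/q = (1/ q) {{≢-nonZero q≢0}}

  module _ {q : ℚ} (q>0 : 0ℚ < q) where

    *-inv-cancel : ∀ a → q * a * inv G q ≡ a
    *-inv-cancel a = begin
      q * a * inv G q    ≡⟨ reassoc q a (inv G q) ⟩
      a * (q * inv G q)  ≡⟨ cong (a *_) (inv-inverseʳ q>0) ⟩
      a * 1ℚ             ≡⟨ *-identityʳ a ⟩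
      a                  ∎
      where
      open ≡-Reasoning
      reassoc : ∀ q a i → q * a * i ≡ a * (q * i)
      reassoc = solve-∀ ℚ-ring

    *inv-mono-≤ : ∀ {a b} → a ≤ b → a * inv G q ≤ b * inv G q
    *inv-mono-≤ = *-monoʳ-≤-nonNeg (inv G q) {{nonNegative (inv-nonNeg q>0)}}

    ≤*⇒*inv≤ : ∀ {a c} → a ≤ q * c → a * inv G q ≤ c
    ≤*⇒*inv≤ {a} a≤qc = subst (a * inv G q ≤_) (*-inv-cancel _) (*inv-mono-≤ a≤qc)

    *≤⇒≤*inv : ∀ {a c} → q * c ≤ a → c ≤ a * inv G q
    *≤⇒≤*inv {a} qc≤a = subst (_≤ a * inv G q) (*-inv-cancel _) (*inv-mono-≤ qc≤a)

    inv*≤⇒≤* : ∀ {a c} → inv G q * a ≤ c → a ≤ q * c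
    inv*≤⇒≤* {a} {c} ia≤c =
      subst (_≤ q * c) (trans (reassoc q (inv G q) a) (*-inv-cancel a)) (*-monoˡ-≤-≥0 (<⇒≤ q>0) ia≤c)
      where
      reassoc : ∀ q i a → q * (i * a) ≡ q * a * i
      reassoc = solve-∀ ℚ-ring

  _⊕_ : LPPoint G → LPPoint G → LPPoint G
  p ⊕ q = lp (λ i → xI p i + xI q i) (λ j → xS p j + xS q j) (λ v → y p v + y q v)

  mapPoint : (ℚ → ℚ) → LPPoint G → LPPoint G
  mapPoint f p = lp (f ∘ xI p) (f ∘ xS p) (f ∘ y p)

  _⊙_ : ℚ → LPPoint G → LPPoint G
  a ⊙ p = mapPoint (a *_) p

  weight : LPPoint G → ℚ
  weight p = dot n w (y p)

  obj-cong : ∀ {p q} → (∀ i → xI p i ≡ xI q i) → (∀ j → xS p j ≡ xS q j) → obj G p ≡ obj G q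
  obj-cong xI≗ xS≗ = cong₂ _-_ (dot-congʳ mI cI xI≗) (dot-congʳ mS cS xS≗)

  weight-cong : ∀ {p q} → (∀ v → y p v ≡ y q v) → weight p ≡ weight q
  weight-cong = dot-congʳ n w

  obj-mono-≤ : ∀ {p q} → (∀ i → xI p i ≤ xI q i) → (∀ j → xS q j ≤ xS p j) → obj G p ≤ obj G q
  obj-mono-≤ xI≤ xS≥ = +-mono-≤ (dot-monoʳ-≤ mI (<⇒≤ ∘ cI>0) xI≤)
                                 (neg-antimono-≤ (dot-monoʳ-≤ mS (<⇒≤ ∘ cS>0) xS≥))

  obj-⊕ : ∀ p q → obj G (p ⊕ q) ≡ obj G p + obj G q
  obj-⊕ p q = trans (cong₂ _-_ (dot-distribʳ-+ mI cI (xI p) (xI q)) (dot-distribʳ-+ mS cS (xS p) (xS q)))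
                    (regroup (dot mI cI (xI p)) (dot mI cI (xI q)) (dot mS cS (xS p)) (dot mS cS (xS q)))
    where
    regroup : ∀ a b c d → (a + b) - (c + d) ≡ (a - c) + (b - d)
    regroup = solve-∀ ℚ-ring

  obj-⊙ : ∀ a p → obj G (a ⊙ p) ≡ a * obj G p
  obj-⊙ a p = trans (cong₂ _-_ (dot-*ʳ mI cI a (xI p)) (dot-*ʳ mS cS a (xS p)))
                    (sym (*-distribˡ-- a (dot mI cI (xI p)) (dot mS cS (xS p))))
    where
    *-distribˡ-- : ∀ a b c → a * (b - c) ≡ a * b - a * c
    *-distribˡ-- = solve-∀ ℚ-ring

  weight-⊕ : ∀ p q → weight (p ⊕ q) ≡ weight p + weight q
  weight-⊕ p q = dot-distribʳ-+ n w (y p) (y q)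

  weight-⊙ : ∀ a p → weight (a ⊙ p) ≡ a * weight p
  weight-⊙ a p = dot-*ʳ n w a (y p)

  module _ {f g : ℚ → ℚ} (f+g≗id : ∀ t → f t + g t ≡ t) (p : LPPoint G) where

    obj-split : obj G p ≡ obj G (mapPoint f p) + obj G (mapPoint g p)
    obj-split = trans (obj-cong {p} {mapPoint f p ⊕ mapPoint g p}
                                (sym ∘ f+g≗id ∘ xI p) (sym ∘ f+g≗id ∘ xS p))
                      (obj-⊕ (mapPoint f p) (mapPoint g p))

    weight-split : weight p ≡ weight (mapPoint f p) + weight (mapPoint g p)
    weight-split = trans (weight-cong {p} {mapPoint f p ⊕ mapPoint g p} (sym ∘ f+g≗id ∘ y p))
                         (weight-⊕ (mapPoint f p) (mapPoint g p))

  record InCone (p : LPPoint G) : Set where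
    field
      xI≤y : ∀ i v → v ∈ eI i → xI p i ≤ y p v
      y≤xS : ∀ j v → v ∈ eS j → y p v ≤ xS p j
      y≥0  : ∀ v → 0ℚ ≤ y p v
      xI≥0 : ∀ i → 0ℚ ≤ xI p i
      xS≥0 : ∀ j → 0ℚ ≤ xS p j
  open InCone

  feasible⇒inCone : ∀ {p} → Feasible G p → InCone p
  feasible⇒inCone (_ , xI≤y , y≤xS , y≥0 , xI≥0 , xS≥0) = record
    { xI≤y = xI≤y ; y≤xS = y≤xS ; y≥0 = y≥0 ; xI≥0 = xI≥0 ; xS≥0 = xS≥0 }

  inCone⇒feasible : ∀ {p} → weight p ≡ 1ℚ → InCone p → Feasible G p
  inCone⇒feasible weight≡1 p∈C = weight≡1 , xI≤y p∈C , y≤xS p∈C , y≥0 p∈C , xI≥0 p∈C , xS≥0 p∈C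

  weight-nonNeg : ∀ {p} → InCone p → 0ℚ ≤ weight p
  weight-nonNeg p∈C = dot-nonNeg n (<⇒≤ ∘ w>0) (y≥0 p∈C)

  ⊕-inCone : ∀ {p q} → InCone p → InCone q → InCone (p ⊕ q)
  ⊕-inCone p∈C q∈C = record
    { xI≤y = λ i v v∈e → +-mono-≤ (xI≤y p∈C i v v∈e) (xI≤y q∈C i v v∈e)
    ; y≤xS = λ j v v∈e → +-mono-≤ (y≤xS p∈C j v v∈e) (y≤xS q∈C j v v∈e)
    ; y≥0  = λ v → +-mono-≤ (y≥0 p∈C v) (y≥0 q∈C v)
    ; xI≥0 = λ i → +-mono-≤ (xI≥0 p∈C i) (xI≥0 q∈C i)
    ; xS≥0 = λ j → +-mono-≤ (xS≥0 p∈C j) (xS≥0 q∈C j)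
    }

  mapPoint-inCone : ∀ {f} → (∀ {s t} → s ≤ t → f s ≤ f t) → (∀ {t} → 0ℚ ≤ t → 0ℚ ≤ f t) →
    ∀ {p} → InCone p → InCone (mapPoint f p)
  mapPoint-inCone f-mono f-nonNeg p∈C = record
    { xI≤y = λ i v v∈e → f-mono (xI≤y p∈C i v v∈e)
    ; y≤xS = λ j v v∈e → f-mono (y≤xS p∈C j v v∈e)
    ; y≥0  = f-nonNeg ∘ y≥0 p∈C
    ; xI≥0 = f-nonNeg ∘ xI≥0 p∈C
    ; xS≥0 = f-nonNeg ∘ xS≥0 p∈C
    }

  ⊙-inCone : ∀ {a p} → 0ℚ ≤ a → InCone p → InCone (a ⊙ p)
  ⊙-inCone 0≤a = mapPoint-inCone (*-monoˡ-≤-≥0 0≤a) (*-nonNeg 0≤a)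

  indicator : Subset n → LPPoint G
  indicator X = lp (λ i → when (eI i ⊆? X) 1ℚ) (λ j → when (nonempty? (eS j ∩ X)) 1ℚ) (λ v → when (v ∈? X) 1ℚ)

  indicator-inCone : ∀ X → InCone (indicator X)
  indicator-inCone X = record
    { xI≤y = xI≤y′
    ; y≤xS = y≤xS′
    ; y≥0  = λ v → when-nonNeg (v ∈? X) 0≤1
    ; xI≥0 = λ i → when-nonNeg (eI i ⊆? X) 0≤1
    ; xS≥0 = λ j → when-nonNeg (nonempty? (eS j ∩ X)) 0≤1
    }
    where
    0≤1 : 0ℚ ≤ 1ℚ
    0≤1 = nonNegative⁻¹ 1ℚ
    xI≤y′ : ∀ i v → v ∈ eI i → when (eI i ⊆? X) 1ℚ ≤ when (v ∈? X) 1ℚ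
    xI≤y′ i v v∈e with eI i ⊆? X | v ∈? X
    ... | yes _    | yes _   = ≤-refl
    ... | yes e⊆X  | no v∉X  = ⊥-elim (v∉X (e⊆X v∈e))
    ... | no _     | v∈?X    = when-nonNeg v∈?X 0≤1
    y≤xS′ : ∀ j v → v ∈ eS j → when (v ∈? X) 1ℚ ≤ when (nonempty? (eS j ∩ X)) 1ℚ
    y≤xS′ j v v∈e with v ∈? X | nonempty? (eS j ∩ X)
    ... | yes _    | yes _   = ≤-refl
    ... | yes v∈X  | no e∩X=∅ = ⊥-elim (e∩X=∅ (v , x∈p∩q⁺ (v∈e , v∈X)))
    ... | no _     | meets?  = when-nonNeg meets? 0≤1

  obj-indicator : ∀ X → obj G (indicator X) ≡ cIX G X - cSX G X
  obj-indicator X = cong₂ _-_ (sumFin-cong mI (λ i → *-when-1 (eI i ⊆? X) (cI i)))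
                              (sumFin-cong mS (λ j → *-when-1 (nonempty? (eS j ∩ X)) (cS j)))

  weight-indicator : ∀ X → weight (indicator X) ≡ wt G X
  weight-indicator X = sumFin-cong n (λ v → *-when-1 (v ∈? X) (w v))

  wt-pos : ∀ {X} → Nonempty X → 0ℚ < wt G X
  wt-pos {X} (v , v∈X) =
    <-≤-trans (subst (0ℚ <_) (sym (when-true (v ∈? X) v∈X)) (w>0 v))
              (term≤sumFin n (λ u → when-nonNeg (u ∈? X) (<⇒≤ (w>0 u))) v)

  module _ {z : LPPoint G} (z-opt : Optimal G z) where

    private
      C = obj G z
      z-feasible = proj₁ z-opt
      z-max = proj₂ z-opt
      z∈C = feasible⇒inCone z-feasible

    obj≤weight*opt : ∀ {q} → InCone q → obj G q ≤ weight q * obj G z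
    obj≤weight*opt {q} q∈C = +-cancelʳ-≤ C (begin
      obj G q + C                         ≡⟨ obj-⊕ q z ⟨
      obj G (q ⊕ z)                       ≤⟨ inv*≤⇒≤* W>0 normalized-bound ⟩
      W * C                               ≡⟨ cong (_* C) W≡ ⟩
      (weight q + 1ℚ) * C                 ≡⟨ *-distribʳ-+ C (weight q) 1ℚ ⟩
      weight q * C + 1ℚ * C               ≡⟨ cong (weight q * C +_) (*-identityˡ C) ⟩
      weight q * C + C                    ∎)
      where
      open ≤-Reasoning
      W = weight (q ⊕ z)
      W≡ : W ≡ weight q + 1ℚ
      W≡ = trans (weight-⊕ q z) (cong (weight q +_) (proj₁ z-feasible))
      W>0 : 0ℚ < W
      W>0 = subst (0ℚ <_) (sym W≡) (+-mono-≤-< (weight-nonNeg q∈C) (positive⁻¹ 1ℚ))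
      normalized-feasible : Feasible G (inv G W ⊙ (q ⊕ z))
      normalized-feasible = inCone⇒feasible
        (trans (weight-⊙ (inv G W) (q ⊕ z)) (trans (*-comm (inv G W) W) (inv-inverseʳ W>0)))
        (⊙-inCone (inv-nonNeg W>0) (⊕-inCone q∈C z∈C))
      normalized-bound : inv G W * obj G (q ⊕ z) ≤ C
      normalized-bound = subst (_≤ C) (obj-⊙ (inv G W) (q ⊕ z)) (z-max _ normalized-feasible)

    δ≤obj : ∀ {X} → Nonempty X → δ G X ≤ obj G z
    δ≤obj {X} X≠∅ = ≤*⇒*inv≤ (wt-pos X≠∅)
      (subst₂ _≤_ (obj-indicator X) (cong (_* C) (weight-indicator X)) (obj≤weight*opt (indicator-inCone X)))

    module _ {P : Subset n} {ρ₀ ρ : ℚ} (0≤ρ₀ : 0ℚ ≤ ρ₀) (ρ₀<ρ : ρ₀ < ρ)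
             (∈P⇒ρ≤y : ∀ {v} → v ∈ P → ρ ≤ y z v) (ρ₀<y⇒∈P : ∀ {v} → ρ₀ < y z v → v ∈ P) where

      private
        d = ρ - ρ₀
        A = cIX G P - cSX G P
        ρ₀≤ρ = <⇒≤ ρ₀<ρ
        top = mapPoint (clamp ρ₀ ρ) z
        rest = mapPoint (residual ρ₀ ρ) z

        ∉P⇒y≤ρ₀ : ∀ {v} → v ∉ P → y z v ≤ ρ₀
        ∉P⇒y≤ρ₀ v∉P = ≮⇒≥ (v∉P ∘ ρ₀<y⇒∈P)

        top-xI≤ : ∀ i → clamp ρ₀ ρ (xI z i) ≤ d * when (eI i ⊆? P) 1ℚ
        top-xI≤ i with eI i ⊆? P
        ... | yes _  = subst (clamp ρ₀ ρ (xI z i) ≤_) (sym (*-identityʳ d)) (clamp≤b-a (xI z i))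
        ... | no e⊈P = ≤-reflexive (trans (clamp-below ρ₀≤ρ xI≤ρ₀) (sym (*-zeroʳ d)))
          where
          xI≤ρ₀ : xI z i ≤ ρ₀
          xI≤ρ₀ = ≮⇒≥ (λ ρ₀<xI → e⊈P (λ v∈e → ρ₀<y⇒∈P (<-≤-trans ρ₀<xI (xI≤y z∈C i _ v∈e))))

        top-xS≥ : ∀ j → d * when (nonempty? (eS j ∩ P)) 1ℚ ≤ clamp ρ₀ ρ (xS z j)
        top-xS≥ j with nonempty? (eS j ∩ P)
        ... | yes (v , v∈e∩P) = ≤-reflexive (trans (*-identityʳ d) (sym (clamp-above ρ₀≤ρ ρ≤xS)))
          where
          ρ≤xS : ρ ≤ xS z j
          ρ≤xS = ≤-trans (∈P⇒ρ≤y (proj₂ (x∈p∩q⁻ (eS j) P v∈e∩P)))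
                         (y≤xS z∈C j v (proj₁ (x∈p∩q⁻ (eS j) P v∈e∩P)))
        ... | no _ = subst (_≤ clamp ρ₀ ρ (xS z j)) (sym (*-zeroʳ d)) (clamp-nonNeg ρ₀≤ρ (xS z j))

        top-y≡ : ∀ v → clamp ρ₀ ρ (y z v) ≡ d * when (v ∈? P) 1ℚ
        top-y≡ v with v ∈? P
        ... | yes v∈P = trans (clamp-above ρ₀≤ρ (∈P⇒ρ≤y v∈P)) (sym (*-identityʳ d))
        ... | no  v∉P = trans (clamp-below ρ₀≤ρ (∉P⇒y≤ρ₀ v∉P)) (sym (*-zeroʳ d))

        obj-top : obj G top ≤ d * A
        obj-top = begin
          obj G top                ≤⟨ obj-mono-≤ {top} {d ⊙ indicator P} top-xI≤ top-xS≥ ⟩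
          obj G (d ⊙ indicator P)  ≡⟨ obj-⊙ d (indicator P) ⟩
          d * obj G (indicator P)  ≡⟨ cong (d *_) (obj-indicator P) ⟩
          d * A                    ∎
          where open ≤-Reasoning

        weight-top : weight top ≡ d * wt G P
        weight-top = trans (weight-cong {top} {d ⊙ indicator P} top-y≡)
                           (trans (weight-⊙ d (indicator P)) (cong (d *_) (weight-indicator P)))

        obj-z-split : C ≡ obj G top + obj G rest
        obj-z-split = obj-split {clamp ρ₀ ρ} {residual ρ₀ ρ} (clamp+residual ρ₀≤ρ) z

        weight-z-split : weight z ≡ weight top + weight rest
        weight-z-split = weight-split {clamp ρ₀ ρ} {residual ρ₀ ρ} (clamp+residual ρ₀≤ρ) z

        rest-inCone : InCone rest
        rest-inCone = mapPoint-inCone residual-mono-≤ (residual-nonNeg 0≤ρ₀) z∈C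

      wt*obj≤cIX-cSX : wt G P * obj G z ≤ cIX G P - cSX G P
      wt*obj≤cIX-cSX =
        *-cancelˡ-≤-pos d {{positive (p<q⇒0<q-p ρ₀<ρ)}} (+-cancelʳ-≤ (R * C) (begin
          d * (wt G P * C) + R * C  ≡⟨ regroup d (wt G P) C R ⟩
          (d * wt G P + R) * C      ≡⟨ cong (λ t → (t + R) * C) weight-top ⟨
          (weight top + R) * C      ≡⟨ cong (_* C) weight-z-split ⟨
          weight z * C              ≡⟨ cong (_* C) (proj₁ z-feasible) ⟩
          1ℚ * C                    ≡⟨ *-identityˡ C ⟩
          C                         ≡⟨ obj-z-split ⟩
          obj G top + obj G rest    ≤⟨ +-mono-≤ obj-top (obj≤weight*opt rest-inCone) ⟩
          d * A + R * C             ∎))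
        where
        open ≤-Reasoning
        R = weight rest
        regroup : ∀ d w c r → d * (w * c) + r * c ≡ (d * w + r) * c
        regroup = solve-∀ ℚ-ring

    levelSet-obj≤δ : ∀ {P} → LevelSet G z P → obj G z ≤ δ G P
    levelSet-obj≤δ {P} (P≠∅ , ρ , ρ>0 , P⇔) with gapBelow n (y z) ρ>0
    ... | ρ₀ , 0≤ρ₀ , ρ₀<ρ , gap = *≤⇒≤*inv (wt-pos P≠∅)
      (wt*obj≤cIX-cSX 0≤ρ₀ ρ₀<ρ (Equivalence.to (P⇔ _)) (λ ρ₀<y → Equivalence.from (P⇔ _) (gap _ ρ₀<y)))

mainTheorem20 : (n : ℕ) (G : Instance n) (z : LPPoint G) → Optimal G z →
    (P : Subset n) → LevelSet G z P → Densest G P × (δ G P ≡ obj G z)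
mainTheorem20 n G z z-opt P P-level@(P≠∅ , _) =
  (P≠∅ , λ X X≠∅ → subst (δ G X ≤_) (sym δP≡obj) (δ≤obj G z-opt X≠∅)) , δP≡obj
  where
  δP≡obj : δ G P ≡ obj G z
  δP≡obj = ≤-antisym (δ≤obj G z-opt P≠∅) (levelSet-obj≤δ G z-opt P-level)
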